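{- Let $x, y \in \mathbb{Z}$ and let $p \geq 3$ be a prime such that $x^2 - 2 = y^p$ and $y \neq -1$. Then: (1) If $y \not\equiv -1 \pmod{p}$, then $x \not\equiv \pm 1 \pmod{p}$. (2) If $y \equiv -1 \pmod{p}$, then $x \equiv \pm 1 \pmod{p^2}$, and more precisely $v_p((x-1)(x+1)) = v_p(y+1) + 1$.
   Context: $v_p(n)$ denotes the $p$-adic valuation of $n$. -}

module Defs where

open import Data.Nat using (ℕ; suc)
open import Data.Integer using (ℤ; +_; _-_; _^_)
open import Data.Integer.Divisibility using (_∣_)
open import Data.Product using (_×_)
open import Relation.Nullary using (¬_)

_≡_[mod_] : ℤ → ℤ → ℤ → Set
a ≡ b [mod m ] = m ∣ (a - b)

-- IsPadicVal p n k : v_p(n) = k, i.e. p^k ∣ n and p^(k+1) ∤ n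
-- (for n ≠ 0 there is exactly one such k; for n = 0 there is none, v_p(0) = ∞)
IsPadicVal : ℕ → ℤ → ℕ → Set
IsPadicVal p n k = ((+ p) ^ k) ∣ n × ¬ (((+ p) ^ suc k) ∣ n)

-- (x - 1)(x + 1) = y ^ p + 1, and y ^ p ≡ y (mod p) by Fermat's little theorem (itself an
-- induction over ℤ on (1 + a) ^ p ≡ 1 + a ^ p), so p divides x ∓ 1 only if p ∣ y + 1; this is (1).
-- If p ∣ y + 1, put u = y + 1 and expand y ^ p = -(1 - u) ^ p = -(1 - p u + C(p,2) u² - u³ R);
-- since p ∣ C(p,2) and p ∣ u this reads y ^ p + 1 = p u (1 + p c), hence
-- v_p((x - 1)(x + 1)) = v_p(u) + 1 ≥ 2. As p ∤ 2 it cannot divide both x - 1 and x + 1, so p²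
-- divides one of them.
module Submission where

open import Defs
open import Algebra.Bundles using (CommutativeSemiring)
open import Data.Fin using (zero; suc; toℕ; fromℕ; inject₁)
open import Data.Fin.Properties using (toℕ-fromℕ; inject₁ℕ<)
open import Data.Integer using (ℤ; +_; -_; _+_; _-_; _*_; _^_; ∣_∣; -[1+_]; 0ℤ; 1ℤ)
open import Data.Integer.Properties
  using (+-*-commutativeSemiring; +-0-monoid; pos-+; pos-*; abs-*; suc-*; ∣i∣≡0⇒i≡0;
         *-identityˡ; *-identityʳ; +-identityʳ; neg-distribˡ-*; ^-zeroˡ; ^-identityʳ; ^-distribˡ-+-*)
import Data.Integer.Divisibility as Unsigned
open import Data.Integer.Divisibility.Signed
  using (divides; ∣ᵤ⇒∣; ∣⇒∣ᵤ; ∣-refl; ∣m∣n⇒∣m+n; ∣m∣n⇒∣m-n; ∣m+n∣n⇒∣m; ∣m⇒∣m*n; ∣n⇒∣m*n)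
  renaming (_∣_ to _∣ℤ_)
open import Data.Integer.Tactic.RingSolver using (solve-∀)
open import Data.Nat as ℕ
  using (ℕ; zero; suc; _<_; _≤_; _≥_; _∸_; _!; z<s; s<s; s≤s; z≤n; NonZero; ≢-nonZero; nonTrivial⇒n>1)
import Data.Nat.Properties as ℕ
import Algebra.Properties.CommutativeSemigroup ℕ.*-commutativeSemigroup as *-CS
open import Data.Nat.Properties
  using (<⇒≤; <⇒≱; ≤-trans; n≤1+n; m∸n≤m; n∸n≡0; m+[n∸m]≡n; m<m*n; m^n≢0; _!*_!≢0)
open import Data.Nat.Combinatorics
  using (_C_; nCn≡1; nC1≡n; nCk≡n!/k![n-k]!; k![n∸k]!∣n!; nCk+nC[k+1]≡[n+1]C[k+1])
open import Data.Nat.Divisibility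
  using (_∣_; _∤_; divides; _∣?_; ∣-trans; ∣⇒≤; m∣m*n; *-cancelˡ-∣; *-cancelʳ-∣; *-monoˡ-∣)
open import Data.Nat.DivMod using (_%_; _/_; m%n<n; m≡m%n+[m/n]*n; m/n*n≡m)
open import Data.Nat.Induction using (<-rec)
open import Data.Nat.Primality
  using (Prime; composite; euclidsLemma; prime⇒nonZero; prime⇒nonTrivial)
open import Data.Product using (∃; ∃₂; ∃-syntax; _×_; _,_)
open import Data.Sum using (_⊎_; inj₁; inj₂; [_,_]′)
open import Data.Vec.Functional using (Vector; tail; init)
open import Function using (id; _∘_; flip)
open import Relation.Binary.PropositionalEquality
  using (_≡_; _≢_; refl; sym; trans; cong; cong₂; subst; subst₂; module ≡-Reasoning)
open import Relation.Nullary using (¬_; Dec; yes; no; contradiction)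

import Algebra.Properties.CommutativeSemiring.Binomial +-*-commutativeSemiring as Binomial
open import Algebra.Definitions.RawMonoid (CommutativeSemiring.+-rawMonoid +-*-commutativeSemiring)
  using (sum) renaming (_×_ to _×ₛ_)
open import Algebra.Properties.Semiring.Exp (CommutativeSemiring.semiring +-*-commutativeSemiring)
  using () renaming (_^_ to _^ₛ_)
open import Algebra.Properties.Monoid.Sum +-0-monoid using (sum-init-last)

prime∤m! : ∀ {p m} → Prime p → m < p → p ∤ m !
prime∤m! {p} {zero}  pp _   p∣1  = <⇒≱ (nonTrivial⇒n>1 p {{prime⇒nonTrivial pp}}) (∣⇒≤ p∣1)
prime∤m! {m = suc m} pp 1+m<p p∣[1+m]! with euclidsLemma (suc m) (m !) pp p∣[1+m]!
... | inj₁ p∣1+m = <⇒≱ 1+m<p (∣⇒≤ p∣1+m)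
... | inj₂ p∣m!  = prime∤m! pp (≤-trans (n≤1+n (suc m)) 1+m<p) p∣m!

prime∣pCk : ∀ {p k} → Prime p → 0 < k → k < p → p ∣ p C k
prime∣pCk {p@(suc q)} {k@(suc j)} pp _ k<p
  with euclidsLemma (p C k) (k ! ℕ.* (p ∸ k) !) pp (subst (p ∣_) (sym pCk*k![p∸k]!≡p!) (m∣m*n (q !)))
  where
  instance _ = k !* (p ∸ k) !≢0
  pCk*k![p∸k]!≡p! : (p C k) ℕ.* (k ! ℕ.* (p ∸ k) !) ≡ p !
  pCk*k![p∸k]!≡p! = trans (cong (ℕ._* (k ! ℕ.* (p ∸ k) !)) (nCk≡n!/k![n-k]! (<⇒≤ k<p)))
                          (m/n*n≡m (k![n∸k]!∣n! (<⇒≤ k<p)))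
... | inj₁ p∣pCk       = p∣pCk
... | inj₂ p∣k![p∸k]! = contradiction p∣k![p∸k]!
  ([ prime∤m! pp k<p , prime∤m! pp (s≤s (m∸n≤m q j)) ]′ ∘ euclidsLemma (k !) ((p ∸ k) !) pp)

prime>2⇒odd : ∀ {p} → Prime p → 2 < p → ∃ λ j → p ≡ suc (j ℕ.* 2)
prime>2⇒odd {p} pp 2<p with p % 2 | m%n<n p 2 | m≡m%n+[m/n]*n p 2
... | 0 | _ | p≡[p/2]*2 = contradiction (composite 2<p (divides (p / 2) p≡[p/2]*2)) (Prime.notComposite pp)
... | 1 | _ | p≡1+[p/2]*2 = p / 2 , p≡1+[p/2]*2
... | suc (suc _) | s≤s (s≤s ()) | _

n≡p^k*w : ∀ {p} → 1 < p → ∀ n → n ≢ 0 → ∃₂ λ k w → n ≡ p ℕ.^ k ℕ.* w × p ∤ w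
n≡p^k*w {p} 1<p = <-rec _ split
  where
  split : ∀ n → (∀ {m} → m < n → m ≢ 0 → ∃₂ λ k w → m ≡ p ℕ.^ k ℕ.* w × p ∤ w) →
          n ≢ 0 → ∃₂ λ k w → n ≡ p ℕ.^ k ℕ.* w × p ∤ w
  split n rec n≢0 with p ∣? n
  ... | no  p∤n = 0 , n , sym (ℕ.*-identityˡ n) , p∤n
  ... | yes (divides q n≡q*p) with rec q<n q≢0
    where
    q≢0 : q ≢ 0
    q≢0 refl = n≢0 n≡q*p
    q<n : q < n
    q<n = subst (q <_) (sym n≡q*p) (m<m*n q p {{≢-nonZero q≢0}} 1<p)
  ... | k , w , q≡p^k*w , p∤w = suc k , w , n≡p^[1+k]*w , p∤w
    where
    n≡p^[1+k]*w : n ≡ p ℕ.* p ℕ.^ k ℕ.* w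
    n≡p^[1+k]*w = trans n≡q*p (trans (cong (ℕ._* p) q≡p^k*w) (*-CS.xy∙z≈zx∙y (p ℕ.^ k) w p))

prime²∣m*n⇒prime²∣m : ∀ {p m n} → Prime p → p ℕ.* p ∣ m ℕ.* n → p ∤ n → p ℕ.* p ∣ m
prime²∣m*n⇒prime²∣m {p} {m} {n} pp p²∣mn p∤n with euclidsLemma m n pp (∣-trans (m∣m*n p) p²∣mn)
... | inj₂ p∣n = contradiction p∣n p∤n
... | inj₁ (divides q refl) = *-monoˡ-∣ p ([ id , flip contradiction p∤n ]′ (euclidsLemma q n pp p∣qn))
  where
  instance _ = prime⇒nonZero pp
  p∣qn : p ∣ q ℕ.* n
  p∣qn = *-cancelʳ-∣ p (subst (p ℕ.* p ∣_) (*-CS.xy∙z≈xz∙y q p n) p²∣mn)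

-- The library's binomial theorem is phrased with the semiring's own power ^ₛ and multiple ×ₛ.
x^ₛn≡x^n : ∀ x n → x ^ₛ n ≡ x ^ n
x^ₛn≡x^n x zero    = refl
x^ₛn≡x^n x (suc n) = cong (x *_) (x^ₛn≡x^n x n)

n×ₛx≡n*x : ∀ n x → n ×ₛ x ≡ + n * x
n×ₛx≡n*x zero    x = refl
n×ₛx≡n*x (suc n) x = trans (cong (_+_ x) (n×ₛx≡n*x n x)) (sym (suc-* (+ n) x))

∣ℤ-sum : ∀ {d n} (t : Vector ℤ n) → (∀ i → d ∣ℤ t i) → d ∣ℤ sum t
∣ℤ-sum {n = zero}  t d∣t = divides 0ℤ refl
∣ℤ-sum {n = suc n} t d∣t = ∣m∣n⇒∣m+n (d∣t zero) (∣ℤ-sum (tail t) (d∣t ∘ suc))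

[1+a]^p≡1+a^p : ∀ {p} → Prime p → ∀ a → + p ∣ℤ (1ℤ + a) ^ p - (1ℤ + a ^ p)
[1+a]^p≡1+a^p {zero}      pp = contradiction (prime⇒nonZero pp) λ ()
[1+a]^p≡1+a^p {p@(suc q)} pp a =
  subst (+ p ∣ℤ_) (sym (trans (cong (_- (1ℤ + a ^ p)) expansion) (cancel (a ^ p) (sum middle))))
        (∣ℤ-sum middle p∣middle)
  where
  t : Vector ℤ (suc p)
  t = Binomial.binomialTerm 1ℤ a p
  middle : Vector ℤ q
  middle = init (tail t)
  first≡a^p : t zero ≡ a ^ p
  first≡a^p = trans (+-identityʳ _) (trans (*-identityˡ _) (x^ₛn≡x^n a p))
  last≡1 : t (fromℕ p) ≡ 1ℤ
  last≡1 = begin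
    t (fromℕ p)                          ≡⟨ cong (λ k → (p C k) ×ₛ (1ℤ ^ₛ k * a ^ₛ (p ∸ k))) (toℕ-fromℕ p) ⟩
    (p C p) ×ₛ (1ℤ ^ₛ p * a ^ₛ (p ∸ p))  ≡⟨ cong₂ (λ c e → c ×ₛ (1ℤ ^ₛ p * a ^ₛ e)) (nCn≡1 p) (n∸n≡0 p) ⟩
    1ℤ ^ₛ p * 1ℤ + 0ℤ                    ≡⟨ trans (+-identityʳ _) (*-identityʳ _) ⟩
    1ℤ ^ₛ p                              ≡⟨ trans (x^ₛn≡x^n 1ℤ p) (^-zeroˡ p) ⟩
    1ℤ                                   ∎
    where open ≡-Reasoning
  expansion : (1ℤ + a) ^ p ≡ a ^ p + (sum middle + 1ℤ)
  expansion = begin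
    (1ℤ + a) ^ p                            ≡⟨ x^ₛn≡x^n (1ℤ + a) p ⟨
    (1ℤ + a) ^ₛ p                           ≡⟨ Binomial.theorem p 1ℤ a ⟩
    t zero + sum (tail t)                   ≡⟨ cong₂ _+_ first≡a^p (sum-init-last (tail t)) ⟩
    a ^ p + (sum middle + t (fromℕ p))      ≡⟨ cong (λ l → a ^ p + (sum middle + l)) last≡1 ⟩
    a ^ p + (sum middle + 1ℤ)               ∎
    where open ≡-Reasoning
  p∣middle : ∀ i → + p ∣ℤ middle i
  p∣middle i = subst (+ p ∣ℤ_) (sym (n×ₛx≡n*x (p C k) b))
                     (∣m⇒∣m*n b (∣ᵤ⇒∣ {+ p} {+ (p C k)} (prime∣pCk pp z<s (s<s (inject₁ℕ< i)))))
    where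
    k = suc (toℕ (inject₁ i))
    b = Binomial.binomial 1ℤ a p (suc (inject₁ i))
  cancel : ∀ A M → A + (M + 1ℤ) - (1ℤ + A) ≡ M
  cancel = solve-∀

fermat-suc : ∀ {p} → Prime p → ∀ a → + p ∣ℤ a ^ p - a → + p ∣ℤ (1ℤ + a) ^ p - (1ℤ + a)
fermat-suc {p} pp a p∣a^p-a =
  subst (+ p ∣ℤ_) (regroup ((1ℤ + a) ^ p) (a ^ p) a) (∣m∣n⇒∣m+n ([1+a]^p≡1+a^p pp a) p∣a^p-a)
  where
  regroup : ∀ B A a → B - (1ℤ + A) + (A - a) ≡ B - (1ℤ + a)
  regroup = solve-∀

fermat-pred : ∀ {p} → Prime p → ∀ a → + p ∣ℤ (1ℤ + a) ^ p - (1ℤ + a) → + p ∣ℤ a ^ p - a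
fermat-pred {p} pp a p∣[1+a]^p-[1+a] =
  subst (+ p ∣ℤ_) (regroup ((1ℤ + a) ^ p) (a ^ p) a) (∣m∣n⇒∣m-n p∣[1+a]^p-[1+a] ([1+a]^p≡1+a^p pp a))
  where
  regroup : ∀ B A a → B - (1ℤ + a) - (B - (1ℤ + A)) ≡ A - a
  regroup = solve-∀

fermat : ∀ {p} → Prime p → ∀ a → + p ∣ℤ a ^ p - a
fermat {zero}  pp _             = contradiction (prime⇒nonZero pp) λ ()
fermat {suc q} pp (+ zero)      = divides 0ℤ refl
fermat {suc q} pp (+ suc n)     = fermat-suc pp (+ n) (fermat pp (+ n))
fermat {suc q} pp -[1+ zero ]   = fermat-pred pp -[1+ zero ] (fermat pp (+ zero))
fermat {suc q} pp -[1+ suc n ]  = fermat-pred pp -[1+ suc n ] (fermat pp -[1+ n ])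

p∣y^p+1⇒p∣y+1 : ∀ {p} → Prime p → ∀ y → + p ∣ℤ y ^ p + 1ℤ → + p ∣ℤ y + 1ℤ
p∣y^p+1⇒p∣y+1 {p} pp y p∣y^p+1 = subst (+ p ∣ℤ_) (cancel (y ^ p) y) (∣m∣n⇒∣m-n p∣y^p+1 (fermat pp y))
  where
  cancel : ∀ Y y → Y + 1ℤ - (Y - y) ≡ y + 1ℤ
  cancel = solve-∀

y+1≡0⇒y≡-1 : ∀ y → y + 1ℤ ≡ 0ℤ → y ≡ - 1ℤ
y+1≡0⇒y≡-1 y y+1≡0 = trans (shift y) (cong (_- 1ℤ) y+1≡0)
  where
  shift : ∀ y → y ≡ y + 1ℤ - 1ℤ
  shift = solve-∀

-‿^-odd : ∀ x j → (- x) ^ suc (j ℕ.* 2) ≡ - (x ^ suc (j ℕ.* 2))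
-‿^-odd x zero    = sym (neg-distribˡ-* x 1ℤ)
-‿^-odd x (suc j) = trans (cong (λ z → - x * (- x * z)) (-‿^-odd x j)) (three-negations x (x ^ suc (j ℕ.* 2)))
  where
  three-negations : ∀ x z → - x * (- x * - z) ≡ - (x * (x * z))
  three-negations = solve-∀

[1+u]^n-expansion : ∀ n u → ∃ λ R → (1ℤ + u) ^ n ≡ 1ℤ + + n * u + + (n C 2) * (u * u) + u * u * u * R
[1+u]^n-expansion zero    u = 0ℤ , base u
  where
  base : ∀ u → 1ℤ ≡ 1ℤ + 0ℤ * u + 0ℤ * (u * u) + u * u * u * 0ℤ
  base = solve-∀
[1+u]^n-expansion (suc n) u with [1+u]^n-expansion n u
... | R , [1+u]^n≡ = R + + (n C 2) + u * R , (begin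
  (1ℤ + u) * (1ℤ + u) ^ n
    ≡⟨ cong ((1ℤ + u) *_) [1+u]^n≡ ⟩
  (1ℤ + u) * (1ℤ + + n * u + + (n C 2) * (u * u) + u * u * u * R)
    ≡⟨ step (+ n) (+ (n C 2)) u R ⟩
  1ℤ + (1ℤ + + n) * u + (+ n + + (n C 2)) * (u * u) + u * u * u * (R + + (n C 2) + u * R)
    ≡⟨ cong (λ c → 1ℤ + + suc n * u + c * (u * u) + u * u * u * (R + + (n C 2) + u * R)) pascal ⟩
  1ℤ + + suc n * u + + (suc n C 2) * (u * u) + u * u * u * (R + + (n C 2) + u * R) ∎)
  where
  open ≡-Reasoning
  step : ∀ N C u R → (1ℤ + u) * (1ℤ + N * u + C * (u * u) + u * u * u * R)
                   ≡ 1ℤ + (1ℤ + N) * u + (N + C) * (u * u) + u * u * u * (R + C + u * R)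
  step = solve-∀
  pascal : + n + + (n C 2) ≡ + (suc n C 2)
  pascal = trans (sym (pos-+ n (n C 2)))
                 (cong +_ (trans (cong (ℕ._+ n C 2) (sym (nC1≡n n))) (nCk+nC[k+1]≡[n+1]C[k+1] n 1)))

y^p+1≡p[y+1][1+pc] : ∀ {p} → Prime p → 2 < p → ∀ {y} → + p ∣ℤ y + 1ℤ →
                    ∃ λ c → y ^ p + 1ℤ ≡ + p * (y + 1ℤ) * (1ℤ + + p * c)
y^p+1≡p[y+1][1+pc] {p} pp 2<p {y} (divides w y+1≡w*p)
  with prime>2⇒odd pp 2<p | prime∣pCk pp (s≤s z≤n) 2<p | [1+u]^n-expansion p (- (y + 1ℤ))
... | j , refl | divides m pC2≡m*p | R , expansion = w * w * R - + m * w , (begin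
  y ^ p + 1ℤ                    ≡⟨ cong (λ z → z ^ p + 1ℤ) (y≡-[1-[y+1]] y) ⟩
  (- (1ℤ + v)) ^ p + 1ℤ         ≡⟨ cong (_+ 1ℤ) (-‿^-odd (1ℤ + v) j) ⟩
  - (1ℤ + v) ^ p + 1ℤ           ≡⟨ cong (λ z → - z + 1ℤ) expansion ⟩
  - (1ℤ + P * v + + (p C 2) * (v * v) + v * v * v * R) + 1ℤ
    ≡⟨ cong (λ c → - (1ℤ + P * v + c * (v * v) + v * v * v * R) + 1ℤ) (trans (cong +_ pC2≡m*p) (pos-* m p)) ⟩
  - (1ℤ + P * v + + m * P * (v * v) + v * v * v * R) + 1ℤ
    ≡⟨ factor y+1≡w*p ⟩
  P * (y + 1ℤ) * (1ℤ + P * (w * w * R - + m * w)) ∎)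
  where
  open ≡-Reasoning
  P = + p
  v = - (y + 1ℤ)
  y≡-[1-[y+1]] : ∀ y → y ≡ - (1ℤ + - (y + 1ℤ))
  y≡-[1-[y+1]] = solve-∀
  identity : ∀ P M w R → let v = - (w * P) in
    - (1ℤ + P * v + M * P * (v * v) + v * v * v * R) + 1ℤ ≡ P * (w * P) * (1ℤ + P * (w * w * R - M * w))
  identity = solve-∀
  factor : ∀ {u} → u ≡ w * P → - (1ℤ + P * - u + + m * P * (- u * - u) + - u * - u * - u * R) + 1ℤ
                             ≡ P * u * (1ℤ + P * (w * w * R - + m * w))
  factor refl = identity P (+ m) w R

pos-^ : ∀ m k → (+ m) ^ k ≡ + (m ℕ.^ k)
pos-^ m zero    = refl
pos-^ m (suc k) = trans (cong (+ m *_) (pos-^ m k)) (sym (pos-* m (m ℕ.^ k)))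

∣n∣≡p^k*w⇒isPadicVal : ∀ {p w} n k → .{{NonZero p}} → p ∤ w → ∣ n ∣ ≡ p ℕ.^ k ℕ.* w → IsPadicVal p n k
∣n∣≡p^k*w⇒isPadicVal {p} {w} n k p∤w ∣n∣≡p^k*w =
  subst₂ _∣_ (cong ∣_∣ (sym (pos-^ p k))) (sym ∣n∣≡p^k*w) (m∣m*n w) ,
  λ p^[1+k]∣n → p∤w (*-cancelˡ-∣ (p ℕ.^ k) {{m^n≢0 p k}}
    (subst₂ _∣_ (trans (cong ∣_∣ (pos-^ p (suc k))) (ℕ.*-comm p _)) ∣n∣≡p^k*w p^[1+k]∣n))

isPadicVal-p*n*z : ∀ {p n z} → Prime p → n ≢ 0ℤ → ¬ (+ p ∣ℤ z) →
                   ∃ λ k → IsPadicVal p n k × IsPadicVal p (+ p * n * z) (suc k)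
isPadicVal-p*n*z {p} {n} {z} pp n≢0 p∤z
  with n≡p^k*w (nonTrivial⇒n>1 p {{prime⇒nonTrivial pp}}) ∣ n ∣ (n≢0 ∘ ∣i∣≡0⇒i≡0)
... | k , w , ∣n∣≡p^k*w , p∤w =
  k , ∣n∣≡p^k*w⇒isPadicVal n k p∤w ∣n∣≡p^k*w , ∣n∣≡p^k*w⇒isPadicVal (+ p * n * z) (suc k) p∤w*∣z∣ ∣pnz∣≡p^[1+k]*w∣z∣
  where
  instance _ = prime⇒nonZero pp
  p∤w*∣z∣ : p ∤ w ℕ.* ∣ z ∣
  p∤w*∣z∣ = [ p∤w , p∤z ∘ ∣ᵤ⇒∣ ]′ ∘ euclidsLemma w ∣ z ∣ pp
  ∣pnz∣≡p^[1+k]*w∣z∣ : ∣ + p * n * z ∣ ≡ p ℕ.* p ℕ.^ k ℕ.* (w ℕ.* ∣ z ∣)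
  ∣pnz∣≡p^[1+k]*w∣z∣ = begin
    ∣ + p * n * z ∣                    ≡⟨ trans (abs-* (+ p * n) z) (cong (ℕ._* ∣ z ∣) (abs-* (+ p) n)) ⟩
    p ℕ.* ∣ n ∣ ℕ.* ∣ z ∣              ≡⟨ cong (λ m → p ℕ.* m ℕ.* ∣ z ∣) ∣n∣≡p^k*w ⟩
    p ℕ.* (p ℕ.^ k ℕ.* w) ℕ.* ∣ z ∣    ≡⟨ cong (ℕ._* ∣ z ∣) (ℕ.*-assoc p _ w) ⟨
    p ℕ.* p ℕ.^ k ℕ.* w ℕ.* ∣ z ∣      ≡⟨ ℕ.*-assoc (p ℕ.* p ℕ.^ k) w ∣ z ∣ ⟩
    p ℕ.* p ℕ.^ k ℕ.* (w ℕ.* ∣ z ∣)    ∎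
    where open ≡-Reasoning

lifting-the-exponent : ∀ {p y} → Prime p → 2 < p → + p ∣ℤ y + 1ℤ → y + 1ℤ ≢ 0ℤ →
                       ∃ λ k → IsPadicVal p (y + 1ℤ) k × IsPadicVal p (y ^ p + 1ℤ) (suc k)
lifting-the-exponent {p} {y} pp 2<p p∣y+1 y+1≢0 with y^p+1≡p[y+1][1+pc] pp 2<p p∣y+1
... | c , y^p+1≡ = subst (λ n → ∃ λ k → IsPadicVal p (y + 1ℤ) k × IsPadicVal p n (suc k)) (sym y^p+1≡)
                         (isPadicVal-p*n*z pp y+1≢0 p∤1+pc)
  where
  p∤1+pc : ¬ (+ p ∣ℤ 1ℤ + + p * c)
  p∤1+pc p∣1+pc = <⇒≱ 2<p (≤-trans (∣⇒≤ (∣⇒∣ᵤ p∣1)) (s≤s z≤n))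
    where
    p∣1 : + p ∣ℤ 1ℤ
    p∣1 = ∣m+n∣n⇒∣m p∣1+pc (∣m⇒∣m*n c ∣-refl)

isPadicVal⇒p^m∣ : ∀ {p k m} n → IsPadicVal p n k → m ≤ k → (+ p) ^ m Unsigned.∣ n
isPadicVal⇒p^m∣ {p} {k} {m} n (p^k∣n , _) m≤k = ∣-trans (∣⇒∣ᵤ p^m∣p^k) p^k∣n
  where
  p^m∣p^k : (+ p) ^ m ∣ℤ (+ p) ^ k
  p^m∣p^k = subst (λ e → (+ p) ^ m ∣ℤ (+ p) ^ e) (m+[n∸m]≡n m≤k)
              (subst ((+ p) ^ m ∣ℤ_) (sym (^-distribˡ-+-* (+ p) m (k ∸ m)))
                (∣m⇒∣m*n _ ∣-refl))

p∣n⇒isPadicVal>0 : ∀ {p k} n → + p Unsigned.∣ n → IsPadicVal p n k → 0 < k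
p∣n⇒isPadicVal>0 {p} {zero} n p∣n (_ , p^1∤n) = contradiction (subst (Unsigned._∣ n) (sym (^-identityʳ (+ p))) p∣n) p^1∤n
p∣n⇒isPadicVal>0 {k = suc k} _ _ _ = s≤s z≤n

∣p^2∣≡p*p : ∀ p → ∣ (+ p) ^ 2 ∣ ≡ p ℕ.* p
∣p^2∣≡p*p p = trans (cong ∣_∣ (pos-^ p 2)) (cong (p ℕ.*_) (ℕ.*-identityʳ p))

odd-prime²∣x²-1⇒x≡±1 : ∀ {p} → Prime p → 2 < p → ∀ x → (+ p) ^ 2 Unsigned.∣ (x - 1ℤ) * (x + 1ℤ) →
                  x ≡ 1ℤ [mod (+ p) ^ 2 ] ⊎ x ≡ - 1ℤ [mod (+ p) ^ 2 ]
odd-prime²∣x²-1⇒x≡±1 {p} pp 2<p x p²∣x²-1 = by-cases (p ∣? ∣ x + 1ℤ ∣)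
  where
  p²∣∣x-1∣∣x+1∣ : p ℕ.* p ∣ ∣ x - 1ℤ ∣ ℕ.* ∣ x + 1ℤ ∣
  p²∣∣x-1∣∣x+1∣ = subst₂ _∣_ (∣p^2∣≡p*p p) (abs-* (x - 1ℤ) (x + 1ℤ)) p²∣x²-1
  p∤2 : ¬ (+ p ∣ℤ + 2)
  p∤2 p∣2 = <⇒≱ 2<p (∣⇒≤ (∣⇒∣ᵤ p∣2))
  not-both : p ∣ ∣ x - 1ℤ ∣ → p ∤ ∣ x + 1ℤ ∣
  not-both p∣x-1 p∣x+1 = p∤2 (subst (+ p ∣ℤ_) (difference x)
    (∣m∣n⇒∣m-n (∣ᵤ⇒∣ {+ p} {x + 1ℤ} p∣x+1) (∣ᵤ⇒∣ {+ p} {x - 1ℤ} p∣x-1)))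
    where
    difference : ∀ x → x + 1ℤ - (x - 1ℤ) ≡ + 2
    difference = solve-∀
  by-cases : Dec (p ∣ ∣ x + 1ℤ ∣) → x ≡ 1ℤ [mod (+ p) ^ 2 ] ⊎ x ≡ - 1ℤ [mod (+ p) ^ 2 ]
  by-cases (yes p∣x+1) = inj₂ (subst (_∣ ∣ x + 1ℤ ∣) (sym (∣p^2∣≡p*p p))
    (prime²∣m*n⇒prime²∣m pp (subst (p ℕ.* p ∣_) (ℕ.*-comm ∣ x - 1ℤ ∣ _) p²∣∣x-1∣∣x+1∣) (λ p∣x-1 → not-both p∣x-1 p∣x+1)))
  by-cases (no p∤x+1)  = inj₁ (subst (_∣ ∣ x - 1ℤ ∣) (sym (∣p^2∣≡p*p p))
    (prime²∣m*n⇒prime²∣m pp p²∣∣x-1∣∣x+1∣ p∤x+1))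

theorem2p3 : (x y : ℤ) (p : ℕ) → Prime p → p ≥ 3 →
    x ^ 2 - + 2 ≡ y ^ p → y ≢ - + 1 →
    ((¬ (y ≡ - + 1 [mod + p ]) →
        ¬ (x ≡ + 1 [mod + p ]) × ¬ (x ≡ - + 1 [mod + p ]))
    × (y ≡ - + 1 [mod + p ] →
        ((x ≡ + 1 [mod (+ p) ^ 2 ]) ⊎ (x ≡ - + 1 [mod (+ p) ^ 2 ]))
        × ∃[ k ] (IsPadicVal p (y + + 1) k
                  × IsPadicVal p ((x - + 1) * (x + + 1)) (suc k))))
theorem2p3 x y p pp p≥3 x²-2≡y^p y≢-1 = x≢±1 , x≡±1
  where
  x²-1≡y^p+1 : (x - 1ℤ) * (x + 1ℤ) ≡ y ^ p + 1ℤ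
  x²-1≡y^p+1 = trans (difference-of-squares x) (cong (_+ 1ℤ) x²-2≡y^p)
    where
    difference-of-squares : ∀ x → (x - 1ℤ) * (x + 1ℤ) ≡ x * (x * 1ℤ) - + 2 + 1ℤ
    difference-of-squares = solve-∀
  p∣x²-1⇒y≡-1 : + p ∣ℤ (x - 1ℤ) * (x + 1ℤ) → y ≡ - 1ℤ [mod + p ]
  p∣x²-1⇒y≡-1 = ∣⇒∣ᵤ ∘ p∣y^p+1⇒p∣y+1 pp y ∘ subst (+ p ∣ℤ_) x²-1≡y^p+1
  x≢±1 : ¬ (y ≡ - 1ℤ [mod + p ]) → ¬ (x ≡ 1ℤ [mod + p ]) × ¬ (x ≡ - 1ℤ [mod + p ])
  x≢±1 y≢-1[p] = (λ x≡1 → y≢-1[p] (p∣x²-1⇒y≡-1 (∣m⇒∣m*n (x + 1ℤ) (∣ᵤ⇒∣ {+ p} {x - 1ℤ} x≡1))))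
               , (λ x≡-1 → y≢-1[p] (p∣x²-1⇒y≡-1 (∣n⇒∣m*n (x - 1ℤ) (∣ᵤ⇒∣ {+ p} {x + 1ℤ} x≡-1))))
  x≡±1 : y ≡ - 1ℤ [mod + p ] →
         (x ≡ 1ℤ [mod (+ p) ^ 2 ] ⊎ x ≡ - 1ℤ [mod (+ p) ^ 2 ])
         × ∃[ k ] (IsPadicVal p (y + 1ℤ) k × IsPadicVal p ((x - 1ℤ) * (x + 1ℤ)) (suc k))
  x≡±1 y≡-1[p] =
    let k , v[y+1] , v[y^p+1] = lifting-the-exponent pp p≥3 (∣ᵤ⇒∣ y≡-1[p]) (y≢-1 ∘ y+1≡0⇒y≡-1 y)
        v[x²-1] = subst (λ n → IsPadicVal p n (suc k)) (sym x²-1≡y^p+1) v[y^p+1]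
        0<k = p∣n⇒isPadicVal>0 {p} {k} (y + 1ℤ) y≡-1[p] v[y+1]
    in odd-prime²∣x²-1⇒x≡±1 pp p≥3 x (isPadicVal⇒p^m∣ {p} {suc k} ((x - 1ℤ) * (x + 1ℤ)) v[x²-1] (s≤s 0<k)) , k , v[y+1] , v[x²-1]
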